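{- Let $\approx$ be a substring consistent equivalence relation and $T$ a string of length $n$. Then $\mathsf{LPF}^{\approx}$ of $T$ is a linear oscillation array, i.e., $\sum_{i=1}^{n-1}|\mathsf{LPF}^{\approx}[i+1]-\mathsf{LPF}^{\approx}[i]|=\mathcal{O}(n)$ (with a constant independent of $\approx$ and $T$).
   Context: A substring consistent equivalence relation (SCER) is an equivalence relation $\approx$ on strings such that $X\approx Y$ implies $|X|=|Y|$ and $X[i\mathinner{.\,.} j]\approx Y[i\mathinner{.\,.} j]$ for all $1\le i\le j\le |X|$. For $T$ of length $n$, $\mathsf{LPF}^{\approx}[i]=\max\{\ell\ge0: T[i\mathinner{.\,.} i+\ell)\approx T[j\mathinner{.\,.} j+\ell)$ for some $j\in[1\mathinner{.\,.} i)\}$ for $i\in[1\mathinner{.\,.} n]$, where $T[i\mathinner{.\,.} i+\ell)=T[i]\cdots T[i+\ell-1]$ (with $i+\ell\le n+1$). -}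

module Defs where

open import Level using (Level)
open import Data.Nat using (ℕ; zero; suc; _+_; _*_; _∸_; _≤_; _<_; ∣_-_∣)
open import Data.List using (List; length; take; drop; map; upTo)
open import Data.Nat.ListAction using (sum)
open import Data.Product using (Σ; _×_; ∃)
open import Data.Sum using (_⊎_)
open import Relation.Binary.PropositionalEquality using (_≡_)
open import Relation.Binary.Structures using (IsEquivalence)

-- Strings over alphabet A are lists.  Positions in the paper are 1-based.
-- T[i .. j] (1 ≤ i ≤ j ≤ |T|) = take (j ∸ i + 1) (drop (i ∸ 1) T)
Sub : {A : Set} → List A → ℕ → ℕ → List A
Sub T i j = take (suc (j ∸ i)) (drop (i ∸ 1) T)

Fac : {A : Set} → List A → ℕ → ℕ → List A
Fac T i ℓ = take ℓ (drop (i ∸ 1) T)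

record IsSCER {A : Set} (_≈_ : List A → List A → Set) : Set where
  field
    isEquivalence : IsEquivalence _≈_
    length-pres   : ∀ {X Y} → X ≈ Y → length X ≡ length Y
    substring     : ∀ {X Y} → X ≈ Y → ∀ i j → 1 ≤ i → i ≤ j → j ≤ length X →
                    Sub X i j ≈ Sub Y i j

Admissible : {A : Set} → (List A → List A → Set) → List A → ℕ → ℕ → Set
Admissible _≈_ T i ℓ =
  Σ ℕ λ j → 1 ≤ j × j < i × i + ℓ ≤ suc (length T) × j + ℓ ≤ suc (length T) ×
            (Fac T i ℓ ≈ Fac T j ℓ)

-- L is the LPF^≈ array of T: for every i ∈ [1..n], L i is the maximum
-- admissible ℓ (by convention 0 when no j exists, i.e. for i = 1).
IsLPF : {A : Set} → (List A → List A → Set) → List A → (ℕ → ℕ) → Set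
IsLPF _≈_ T L =
  ∀ i → 1 ≤ i → i ≤ length T →
    ((L i ≡ 0) ⊎ Admissible _≈_ T i (L i)) ×
    (∀ ℓ → Admissible _≈_ T i ℓ → ℓ ≤ L i)

oscillation : (ℕ → ℕ) → ℕ → ℕ
oscillation L n = sum (map (λ k → ∣ L (suc (suc k)) - L (suc k) ∣) (upTo (n ∸ 1)))

{-# OPTIONS --safe #-}
-- A previous occurrence of T[i .. i+ℓ) with ℓ ≥ 1, shifted right by one
-- position, is a previous occurrence of T[i+1 .. i+ℓ), because an SCER is
-- closed under dropping the first character.  Hence LPF[i] ≤ LPF[i+1] + 1,
-- and LPF[n] ≤ 1.  For a sequence that drops by at most one per step,
-- |LPF[i+1] − LPF[i]| ≤ LPF[i+1] − LPF[i] + 2, so the oscillation telescopes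
-- to at most 2(n − 1) + LPF[n] ≤ 2n.
module Submission where

open import Defs
open import Data.Nat using (ℕ; zero; suc; _+_; _*_; _≤_; z≤n; s≤s; ∣_-_∣; _≤?_)
open import Data.Nat.Properties
open import Data.List using (List; []; _∷_; length; take; drop)
open import Data.Nat.ListAction using (sum)
open import Data.List.Properties using (take-all; take-drop; drop-drop; drop-all; map-applyUpTo)
open import Data.Product using (Σ; _,_; proj₁; proj₂)
open import Data.Sum using (inj₁; inj₂)
open import Function using (_∘_; id)
open import Relation.Nullary using (yes; no)
open import Relation.Binary.PropositionalEquality
  using (_≡_; refl; sym; trans; cong; subst; subst₂; module ≡-Reasoning)
open import Relation.Binary.Structures using (IsEquivalence)

Sub-from-2 : {A : Set} (X : List A) → Sub X 2 (length X) ≡ drop 1 X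
Sub-from-2 []           = refl
Sub-from-2 (_ ∷ [])     = refl
Sub-from-2 (_ ∷ y ∷ ys) = cong (y ∷_) (take-all (length ys) ys ≤-refl)

drop₁-Fac : {A : Set} (T : List A) {i : ℕ} (ℓ : ℕ) → 1 ≤ i →
            drop 1 (Fac T i (suc ℓ)) ≡ Fac T (suc i) ℓ
drop₁-Fac T {suc i} ℓ _ = begin
  drop 1 (take (suc ℓ) (drop i T)) ≡⟨ take-drop ℓ 1 (drop i T) ⟨
  take ℓ (drop 1 (drop i T))       ≡⟨ cong (take ℓ) (drop-drop i 1 T) ⟩
  take ℓ (drop (i + 1) T)          ≡⟨ cong (λ k → take ℓ (drop k T)) (+-comm i 1) ⟩
  take ℓ (drop (suc i) T)          ∎
  where open ≡-Reasoning

m+∣n-m∣≤2+n : ∀ m n → m ≤ suc n → m + ∣ n - m ∣ ≤ 2 + n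
m+∣n-m∣≤2+n zero          n       _         = ≤-trans (≤-reflexive (∣-∣-identityʳ n)) (m≤n+m n 2)
m+∣n-m∣≤2+n (suc zero)    zero    _         = ≤-refl
m+∣n-m∣≤2+n (suc (suc m)) zero    (s≤s ())
m+∣n-m∣≤2+n (suc m)       (suc n) (s≤s m≤n) = s≤s (m+∣n-m∣≤2+n m n m≤n)

oscillation-suc : ∀ (L : ℕ → ℕ) m →
                  oscillation L (2 + m) ≡ ∣ L 2 - L 1 ∣ + oscillation (L ∘ suc) (suc m)
oscillation-suc L m = cong (∣ L 2 - L 1 ∣ +_) (cong sum
  (trans (map-applyUpTo suc g m) (sym (map-applyUpTo id (g ∘ suc) m))))
  where
  g : ℕ → ℕ
  g k = ∣ L (suc (suc k)) - L (suc k) ∣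

oscillation-bound : ∀ m (L : ℕ → ℕ) → (∀ k → 1 ≤ k → k ≤ m → L k ≤ suc (L (suc k))) →
                    L 1 + oscillation L (suc m) ≤ m * 2 + L (suc m)
oscillation-bound zero    L _      = ≤-reflexive (+-identityʳ (L 1))
oscillation-bound (suc m) L drop≤1 = begin
  L 1 + oscillation L (2 + m)  ≡⟨ cong (L 1 +_) (oscillation-suc L m) ⟩
  L 1 + (∣ L 2 - L 1 ∣ + osc)  ≡⟨ +-assoc (L 1) _ osc ⟨
  (L 1 + ∣ L 2 - L 1 ∣) + osc  ≤⟨ +-monoˡ-≤ osc (m+∣n-m∣≤2+n (L 1) (L 2) (drop≤1 1 ≤-refl (s≤s z≤n))) ⟩
  2 + (L 2 + osc)              ≤⟨ s≤s (s≤s (oscillation-bound m (L ∘ suc) shifted)) ⟩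
  suc m * 2 + L (2 + m)        ∎
  where
  open ≤-Reasoning
  osc : ℕ
  osc = oscillation (L ∘ suc) (suc m)
  shifted : ∀ k → 1 ≤ k → k ≤ m → L (suc k) ≤ suc (L (suc (suc k)))
  shifted k _ k≤m = drop≤1 (suc k) (s≤s z≤n) (s≤s k≤m)

module _ {A : Set} {_≈_ : List A → List A → Set} (scer : IsSCER _≈_) where
  open IsSCER scer
  open IsEquivalence isEquivalence using () renaming (refl to ≈-refl)

  drop₁-≈ : ∀ {X Y} → X ≈ Y → drop 1 X ≈ drop 1 Y
  drop₁-≈ {X} {Y} X≈Y with 2 ≤? length X
  ... | yes 2≤|X| = subst₂ _≈_ (Sub-from-2 X)
                      (trans (cong (Sub Y 2) (length-pres X≈Y)) (Sub-from-2 Y))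
                      (substring X≈Y 2 (length X) (s≤s z≤n) 2≤|X| ≤-refl)
  ... | no  2≰|X| = subst₂ _≈_ (sym (drop-all 1 X |X|≤1)) (sym (drop-all 1 Y |Y|≤1)) ≈-refl
    where
    |X|≤1 : length X ≤ 1
    |X|≤1 = ≤-pred (≰⇒> 2≰|X|)
    |Y|≤1 : length Y ≤ 1
    |Y|≤1 = subst (_≤ 1) (length-pres X≈Y) |X|≤1

  Admissible-suc : ∀ {T i ℓ} → Admissible _≈_ T i (suc ℓ) → Admissible _≈_ T (suc i) ℓ
  Admissible-suc {T} {i} {ℓ} (j , 1≤j , j<i , i+1+ℓ≤ , j+1+ℓ≤ , Ti≈Tj) =
    suc j , s≤s z≤n , s≤s j<i ,
    subst (_≤ suc (length T)) (+-suc i ℓ) i+1+ℓ≤ , subst (_≤ suc (length T)) (+-suc j ℓ) j+1+ℓ≤ ,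
    subst₂ _≈_ (drop₁-Fac T ℓ (≤-trans 1≤j (<⇒≤ j<i))) (drop₁-Fac T ℓ 1≤j) (drop₁-≈ Ti≈Tj)

  module _ {T : List A} {L : ℕ → ℕ} (lpf : IsLPF _≈_ T L) where

    LPF-drop≤1 : ∀ {i} → 1 ≤ i → suc i ≤ length T → L i ≤ suc (L (suc i))
    LPF-drop≤1 {i} 1≤i i<n with proj₁ (lpf i 1≤i (<⇒≤ i<n))
    ... | inj₁ Li≡0 rewrite Li≡0 = z≤n
    ... | inj₂ adm  = admissible≤ (L i) adm
      where
      admissible≤ : ∀ ℓ → Admissible _≈_ T i ℓ → ℓ ≤ suc (L (suc i))
      admissible≤ zero    _ = z≤n
      admissible≤ (suc ℓ) a = s≤s (proj₂ (lpf (suc i) (s≤s z≤n) i<n) ℓ (Admissible-suc a))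

    LPF-last≤1 : 1 ≤ length T → L (length T) ≤ 1
    LPF-last≤1 1≤n with proj₁ (lpf (length T) 1≤n ≤-refl)
    ... | inj₁ Ln≡0 rewrite Ln≡0 = z≤n
    ... | inj₂ (_ , _ , _ , n+Ln≤1+n , _) =
      +-cancelˡ-≤ (length T) (L (length T)) 1 (≤-trans n+Ln≤1+n (≤-reflexive (+-comm 1 (length T))))

  LPF-oscillation≤ : (T : List A) (L : ℕ → ℕ) → IsLPF _≈_ T L →
                     oscillation L (length T) ≤ 2 * length T
  LPF-oscillation≤ []       _ _   = z≤n
  LPF-oscillation≤ (_ ∷ xs) L lpf = begin
    oscillation L (suc m)        ≤⟨ m≤n+m _ (L 1) ⟩
    L 1 + oscillation L (suc m)  ≤⟨ oscillation-bound m L (λ k 1≤k k≤m → LPF-drop≤1 lpf 1≤k (s≤s k≤m)) ⟩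
    m * 2 + L (suc m)            ≤⟨ +-monoʳ-≤ (m * 2) (LPF-last≤1 lpf (s≤s z≤n)) ⟩
    m * 2 + 1                    ≡⟨ +-comm (m * 2) 1 ⟩
    suc (m * 2)                  ≤⟨ n≤1+n _ ⟩
    suc m * 2                    ≡⟨ *-comm (suc m) 2 ⟩
    2 * suc m                    ∎
    where
    open ≤-Reasoning
    m : ℕ
    m = length xs

lemma26 : Σ ℕ λ C → (A : Set) → (_≈_ : List A → List A → Set) → IsSCER _≈_ →
    (T : List A) → (L : ℕ → ℕ) → IsLPF _≈_ T L →
    oscillation L (length T) ≤ C * length T
lemma26 = 2 , λ _ _ scer → LPF-oscillation≤ scer
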